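{- Let $E$ be a finite set (the edge set of a graph with a fixed reference orientation) and let $\varphi:\{0,1\}^E\to 2^E$ be any map from discrete orientations to subsets of $E$. The following are equivalent: (a) $[0,1]^E=\biguplus_{\overrightarrow{O}\in\{0,1\}^E}\mathrm{hoc}(\overrightarrow{O},\varphi(\overrightarrow{O}))$ (disjoint union); (b) $\varphi$ is bijective and for any two distinct $\overrightarrow{O_1},\overrightarrow{O_2}\in\{0,1\}^E$, $\mathrm{hoc}(\overrightarrow{O_1},\varphi(\overrightarrow{O_1}))\cap\mathrm{hoc}(\overrightarrow{O_2},\varphi(\overrightarrow{O_2}))=\emptyset$; (c) for any two distinct $\overrightarrow{O_1},\overrightarrow{O_2}\in\{0,1\}^E$ there exists $e\in E$ with $\overrightarrow{O_1}(e)\neq\overrightarrow{O_2}(e)$ and $e\in\varphi(\overrightarrow{O_1})\triangle\varphi(\overrightarrow{O_2})$; (d) $\varphi$ is locally bijective: for every $P\subseteq E$ and every orientation $\overrightarrow{O_P}\in\{0,1\}^P$ of $P$, the map $\{0,1\}^{E\setminus P}\to 2^{E\setminus P}$, $\overrightarrow{O_{E\setminus P}}\mapsto\varphi(\overrightarrow{O_{E\setminus P}}\cup\overrightarrow{O_P})\setminus P$, is bijective.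
   Context: Discrete orientations are identified with $\{0,1\}^E$ and continuous orientations with $[0,1]^E$ (coordinate in $(0,1)$ means the edge is bi-oriented); $\overrightarrow{O}(e)$ is the coordinate of $\overrightarrow{O}$ at $e$, and $\overrightarrow{O_{E\setminus P}}\cup\overrightarrow{O_P}$ is the orientation of $E$ restricting to the two given ones. For $\overrightarrow{O}\in\{0,1\}^E$ and $S\subseteq E$, $\mathrm{hoc}(\overrightarrow{O},S)$ is the set of $x\in[0,1]^E$ with $x_e=\overrightarrow{O}(e)$ for $e\notin S$, and for $e\in S$: $x_e\in[0,1)$ if $\overrightarrow{O}(e)=0$, $x_e\in(0,1]$ if $\overrightarrow{O}(e)=1$.
   Formalization: The continuous orientations, the points of $[0,1]^E$ in conditions (a) and (b), have rational coordinates. -}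

module Defs where

open import Data.Nat using (ℕ)
open import Data.Bool using (Bool; true; false; if_then_else_)
open import Data.Fin using (Fin)
open import Data.Vec using (Vec; lookup; tabulate)
open import Data.Fin.Subset using (Subset; _∈_; _∉_; _⊆_; ∁; _─_)
open import Data.Rational using (ℚ; 0ℚ; 1ℚ; _≤_; _<_)
open import Data.Product using (_×_; Σ; ∃; ∃-syntax)
open import Data.Sum using (_⊎_)
open import Relation.Binary.PropositionalEquality using (_≡_; _≢_)
open import Relation.Nullary using (¬_)
open import Function using (Bijective)

-- Edge set E = Fin n.  Discrete orientation: {0,1}^E as Vec Bool n
-- (false = 0 = reference orientation, true = 1 = reversed).
Orientation : ℕ → Set
Orientation n = Vec Bool n

Point : ℕ → Set
Point n = Fin n → ℚ

bit : Bool → ℚ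
bit false = 0ℚ
bit true  = 1ℚ

InCube : ∀ {n} → Point n → Set
InCube {n} x = ∀ (e : Fin n) → 0ℚ ≤ x e × x e ≤ 1ℚ

hocCoord : Bool → Bool → ℚ → Set
hocCoord false o    q = q ≡ bit o
hocCoord true false q = 0ℚ ≤ q × q < 1ℚ
hocCoord true true  q = 0ℚ < q × q ≤ 1ℚ

InHoc : ∀ {n} → Orientation n → Subset n → Point n → Set
InHoc {n} O S x = ∀ (e : Fin n) → hocCoord (lookup S e) (lookup O e) (x e)

_∈△_,_ : ∀ {n} → Fin n → Subset n → Subset n → Set
e ∈△ A , B = (e ∈ A × e ∉ B) ⊎ (e ∉ A × e ∈ B)

-- (a) [0,1]^E is the disjoint union of the hoc(O, φ(O))
-- (each hoc(O,S) ⊆ [0,1]^E holds automatically)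
PartitionsCube : ∀ {n} → (Orientation n → Subset n) → Set
PartitionsCube {n} φ =
  (∀ (x : Point n) → InCube x → ∃[ O ] InHoc O (φ O) x) ×
  (∀ (O₁ O₂ : Orientation n) (x : Point n) →
     InHoc O₁ (φ O₁) x → InHoc O₂ (φ O₂) x → O₁ ≡ O₂)

BijectiveAndDisjoint : ∀ {n} → (Orientation n → Subset n) → Set
BijectiveAndDisjoint {n} φ =
  Bijective _≡_ _≡_ φ ×
  (∀ (O₁ O₂ : Orientation n) → O₁ ≢ O₂ → ∀ (x : Point n) →
     ¬ (InHoc O₁ (φ O₁) x × InHoc O₂ (φ O₂) x))

SeparatingCondition : ∀ {n} → (Orientation n → Subset n) → Set
SeparatingCondition {n} φ =
  ∀ (O₁ O₂ : Orientation n) → O₁ ≢ O₂ →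
    ∃[ e ] (lookup O₁ e ≢ lookup O₂ e × e ∈△ φ O₁ , φ O₂)

-- O_{E∖P} ∪ O_P : take the values of OP on P and of OQ off P
-- (only the P-coordinates of OP and the (E∖P)-coordinates of OQ matter).
glue : ∀ {n} → Subset n → Orientation n → Orientation n → Orientation n
glue P OP OQ = tabulate (λ e → if lookup P e then lookup OP e else lookup OQ e)

-- {0,1}^{E∖P} is represented by orientations of E that are 0 on P
-- (a canonical padding); 2^{E∖P} by subsets of E contained in ∁ P.
ZeroOn : ∀ {n} → Subset n → Orientation n → Set
ZeroOn {n} P O = ∀ (e : Fin n) → e ∈ P → lookup O e ≡ false

LocallyBijective : ∀ {n} → (Orientation n → Subset n) → Set
LocallyBijective {n} φ =
  ∀ (P : Subset n) (OP : Orientation n) →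
    (∀ (O O′ : Orientation n) → ZeroOn P O → ZeroOn P O′ →
       φ (glue P OP O) ─ P ≡ φ (glue P OP O′) ─ P → O ≡ O′) ×
    (∀ (S : Subset n) → S ⊆ ∁ P →
       Σ (Orientation n) (λ O → ZeroOn P O × φ (glue P OP O) ─ P ≡ S))

{-# OPTIONS --safe #-}
module Submission where

-- A point of [0,1]^E lies in hoc(O,S) iff its face does, where a face is a product of the parts
-- {0}, {1} and (0,1) of [0,1]; so all four conditions are statements about how the 3^|E| faces
-- are shared among the cells hoc(O, φ O).
-- (c) ⇒ (b): a coordinate as in (c) separates the two cells and their labels, so φ is injective,
-- hence bijective.  (c) ⇔ (d): (c) is inherited by the localisation of φ at (P, O_P), which is
-- bijective iff φ is locally bijective there; conversely localise at the set where two
-- orientations agree.  (b) ⇒ (a): disjointness and bijectivity of φ give an injective self-map of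
-- the 3^|E| faces whose image consists of covered faces; being onto, it shows every face is covered.
-- (a) ⇒ (c): the cells meeting a subcube tile it, and slicing along the first free coordinate
-- shows by induction that the labels of a tiling are pairwise distinct off the fixed coordinates.

open import Defs
open import Axiom.UniquenessOfIdentityProofs using (module Decidable⇒UIP)
open import Data.Bool using (Bool; true; false; not; if_then_else_)
open import Data.Bool.Properties using (not-¬; ¬-not) renaming (_≟_ to _≟ᵇ_)
open import Data.Empty using (⊥; ⊥-elim)
open import Data.Fin using (Fin; zero; suc; punchOut)
open import Data.Fin.Properties
  using (any?; ¬∀⟶∃¬; injective⇒≤; punchOut-injective; *↔×; 2↔Bool) renaming (_≟_ to _≟ᶠ_)
open import Data.Fin.Subset using (Subset; _∈_; _⊆_; ∁; _─_)
open import Data.Fin.Subset.Properties using (x∈p⇒x∉∁p)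
open import Data.Nat using (ℕ; zero; suc; _^_)
open import Data.Nat.Properties using (1+n≰n)
open import Data.Product using (_×_; _,_; proj₁; proj₂; Σ; ∃-syntax; ∃!; uncurry)
open import Data.Product.Function.NonDependent.Propositional using (_×-↔_)
open import Data.Product.Properties using (Σ-≡,≡→≡)
open import Data.Rational using (ℚ; 0ℚ; 1ℚ; ½; _≤_; _<_)
open import Data.Rational.Properties using (_≟_; _<?_; ≤-refl; <⇒≤; <-irrefl; <-cmp; <-≤-trans)
open import Data.Sum using (inj₁; inj₂)
open import Data.Vec using (Vec; []; _∷_; lookup; tabulate; uncons; replicate; map; zipWith)
open import Data.Vec.Properties
  using ( lookup∘tabulate; tabulate∘lookup; tabulate-cong; []=⇒lookup; lookup⇒[]=; ≡-dec; lookup-replicate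
        ; ∷-injective)
open import Function
  using ( _∘_; _↔_; _⇔_; mk⇔; mk↔ₛ′; Equivalence; Inverse; Injection; Injective; Surjective; StrictlySurjective
        ; Bijective)
open import Function.Consequences.Propositional using (strictlySurjective⇒surjective)
import Function.Construct.Composition as Comp
open import Function.Properties.Inverse using (↔-sym; ↔-trans; ↔⇒↣)
open import Relation.Binary.Definitions using (tri<; tri≈; tri>)
open import Relation.Binary.PropositionalEquality
  using (_≡_; _≢_; refl; sym; trans; cong; cong₂; subst; subst₂; module ≡-Reasoning)
open import Relation.Nullary using (¬_; ¬?; Dec; does; yes; no; contradiction)
open import Relation.Nullary.Decidable using (_×-dec_; decidable-stable; from-yes)

open Equivalence using (to; from)

-- Faces of the cube

data Part : Set where
  end   : Bool → Part
  inner : Part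

Face : ℕ → Set
Face = Vec Part

hocPart : Bool → Bool → Part → Set
hocPart s o (end b) = b ≡ o
hocPart s o inner   = s ≡ true

FaceInHoc : ∀ {n} → (Fin n → Bool) → (Fin n → Bool) → Face n → Set
FaceInHoc o s f = ∀ e → hocPart (s e) (o e) (lookup f e)

partCentre : Part → ℚ
partCentre (end b) = bit b
partCentre inner   = ½

centre : ∀ {n} → Face n → Point n
centre f e = partCentre (lookup f e)

partOf : ℚ → Part
partOf q with q ≟ 0ℚ | q ≟ 1ℚ
... | yes _ | _     = end false
... | no _  | yes _ = end true
... | no _  | no _  = inner

faceOf : ∀ {n} → Point n → Face n
faceOf x = tabulate (partOf ∘ x)

partOf-partCentre : ∀ t → partOf (partCentre t) ≡ t
partOf-partCentre (end false) = refl
partOf-partCentre (end true)  = refl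
partOf-partCentre inner       = refl

0<1 : 0ℚ < 1ℚ
0<1 = from-yes (0ℚ <? 1ℚ)

0<½ : 0ℚ < ½
0<½ = from-yes (0ℚ <? ½)

½<1 : ½ < 1ℚ
½<1 = from-yes (½ <? 1ℚ)

≤∧≢⇒< : ∀ {p q} → p ≤ q → p ≢ q → p < q
≤∧≢⇒< {p} {q} p≤q p≢q with <-cmp p q
... | tri< p<q _ _ = p<q
... | tri≈ _ p≡q _ = contradiction p≡q p≢q
... | tri> _ _ q<p = contradiction (<-≤-trans q<p p≤q) (<-irrefl refl)

partCentre∈[0,1] : ∀ t → 0ℚ ≤ partCentre t × partCentre t ≤ 1ℚ
partCentre∈[0,1] (end false) = ≤-refl , <⇒≤ 0<1
partCentre∈[0,1] (end true)  = <⇒≤ 0<1 , ≤-refl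
partCentre∈[0,1] inner       = <⇒≤ 0<½ , <⇒≤ ½<1

centre-inCube : ∀ {n} (f : Face n) → InCube (centre f)
centre-inCube f e = partCentre∈[0,1] (lookup f e)

hocCoord⇒∈[0,1] : ∀ {s o q} → hocCoord s o q → 0ℚ ≤ q × q ≤ 1ℚ
hocCoord⇒∈[0,1] {false} {o}   refl        = partCentre∈[0,1] (end o)
hocCoord⇒∈[0,1] {true}  {false} (0≤q , q<1) = 0≤q , <⇒≤ q<1
hocCoord⇒∈[0,1] {true}  {true}  (0<q , q≤1) = <⇒≤ 0<q , q≤1

hocCoord-bit⇔ : ∀ s o b → hocCoord s o (bit b) ⇔ b ≡ o
hocCoord-bit⇔ false false false = mk⇔ (λ _ → refl) (λ _ → refl)
hocCoord-bit⇔ false false true  = mk⇔ (λ ()) (λ ())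
hocCoord-bit⇔ false true  false = mk⇔ (λ ()) (λ ())
hocCoord-bit⇔ false true  true  = mk⇔ (λ _ → refl) (λ _ → refl)
hocCoord-bit⇔ true  false false = mk⇔ (λ _ → refl) (λ _ → ≤-refl , 0<1)
hocCoord-bit⇔ true  false true  = mk⇔ (λ (_ , 1<1) → contradiction 1<1 (<-irrefl refl)) (λ ())
hocCoord-bit⇔ true  true  false = mk⇔ (λ (0<0 , _) → contradiction 0<0 (<-irrefl refl)) (λ ())
hocCoord-bit⇔ true  true  true  = mk⇔ (λ _ → refl) (λ _ → 0<1 , ≤-refl)

hocCoord⇔hocPart : ∀ {s o q} → 0ℚ ≤ q → q ≤ 1ℚ → hocCoord s o q ⇔ hocPart s o (partOf q)
hocCoord⇔hocPart {s} {o} {q} 0≤q q≤1 with q ≟ 0ℚ | q ≟ 1ℚ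
... | yes refl | _        = hocCoord-bit⇔ s o false
... | no _     | yes refl = hocCoord-bit⇔ s o true
... | no q≢0   | no q≢1   = interior s o
  where
  interior : ∀ s o → hocCoord s o q ⇔ s ≡ true
  interior false false = mk⇔ (λ q≡0 → contradiction q≡0 q≢0) (λ ())
  interior false true  = mk⇔ (λ q≡1 → contradiction q≡1 q≢1) (λ ())
  interior true  false = mk⇔ (λ _ → refl) (λ _ → 0≤q , ≤∧≢⇒< q≤1 q≢1)
  interior true  true  = mk⇔ (λ _ → refl) (λ _ → ≤∧≢⇒< 0≤q (q≢0 ∘ sym) , q≤1)

hocCoord⇒hocPart : ∀ {s o q} → hocCoord s o q → hocPart s o (partOf q)
hocCoord⇒hocPart h = to (uncurry hocCoord⇔hocPart (hocCoord⇒∈[0,1] h)) h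

hocCoord-partCentre⇔ : ∀ {s o} t → hocCoord s o (partCentre t) ⇔ hocPart s o t
hocCoord-partCentre⇔ {s} {o} t = subst (λ u → hocCoord s o (partCentre t) ⇔ hocPart s o u)
  (partOf-partCentre t) (uncurry hocCoord⇔hocPart (partCentre∈[0,1] t))

centre∈hoc⇔ : ∀ {n} (O S : Vec Bool n) (f : Face n) →
              InHoc O S (centre f) ⇔ FaceInHoc (lookup O) (lookup S) f
centre∈hoc⇔ O S f = mk⇔ (λ h e → to (hocCoord-partCentre⇔ (lookup f e)) (h e))
                        (λ h e → from (hocCoord-partCentre⇔ (lookup f e)) (h e))

faceOf∈hoc⇒∈hoc : ∀ {n} (O S : Vec Bool n) {x : Point n} →
                  InCube x → FaceInHoc (lookup O) (lookup S) (faceOf x) → InHoc O S x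
faceOf∈hoc⇒∈hoc O S {x} cube h e = from (uncurry hocCoord⇔hocPart (cube e))
  (subst (hocPart _ _) (lookup∘tabulate (partOf ∘ x) e) (h e))

hocPart-disjoint : ∀ {s s′ o o′} t → o ≢ o′ → s ≢ s′ → hocPart s o t → hocPart s′ o′ t → ⊥
hocPart-disjoint (end b) o≢o′ _    b≡o    b≡o′    = o≢o′ (trans (sym b≡o) b≡o′)
hocPart-disjoint inner   _    s≢s′ s≡true s′≡true = s≢s′ (trans s≡true (sym s′≡true))

hocPart-irrelevant : ∀ {s o} t (h h′ : hocPart s o t) → h ≡ h′
hocPart-irrelevant (end _) = Decidable⇒UIP.≡-irrelevant _≟ᵇ_
hocPart-irrelevant inner   = Decidable⇒UIP.≡-irrelevant _≟ᵇ_

-- Injective self-maps of finite types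

Fin-injective⇒surjective : ∀ {m} {f : Fin m → Fin m} → Injective _≡_ _≡_ f → StrictlySurjective _≡_ f
Fin-injective⇒surjective {suc m} {f} f-inj y with any? (λ x → f x ≟ᶠ y)
... | yes hit = hit
... | no miss = contradiction (injective⇒≤ avoid-inj) 1+n≰n
  where
  y≢f : ∀ x → y ≢ f x
  y≢f x y≡fx = miss (x , sym y≡fx)
  avoid : Fin (suc m) → Fin m
  avoid x = punchOut (y≢f x)
  avoid-inj : Injective _≡_ _≡_ avoid
  avoid-inj {x} {x′} eq = f-inj (punchOut-injective (y≢f x) (y≢f x′) eq)

finite-injective⇒surjective : ∀ {A : Set} {m} → A ↔ Fin m →
                              {F : A → A} → Injective _≡_ _≡_ F → StrictlySurjective _≡_ F
finite-injective⇒surjective {A} {m} A↔ {F} F-inj y =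
  let i , F[i]≡y = Fin-injective⇒surjective code-inj (Inverse.to A↔ y) in Inverse.from A↔ i , to-inj F[i]≡y
  where
  to-inj : Injective _≡_ _≡_ (Inverse.to A↔)
  to-inj = Injection.injective (↔⇒↣ A↔)
  from-inj : Injective _≡_ _≡_ (Inverse.from A↔)
  from-inj = Injection.injective (↔⇒↣ (↔-sym A↔))
  code-inj : Injective _≡_ _≡_ (Inverse.to A↔ ∘ F ∘ Inverse.from A↔)
  code-inj = Comp.injective _≡_ _≡_ _≡_ from-inj (Comp.injective _≡_ _≡_ _≡_ F-inj to-inj)

Vec↔Fin^ : ∀ {A : Set} {k} n → A ↔ Fin k → Vec A n ↔ Fin (k ^ n)
Vec↔Fin^ zero    _  = mk↔ₛ′ (λ _ → zero) (λ _ → []) (λ { zero → refl }) (λ { [] → refl })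
Vec↔Fin^ {A} (suc n) A↔ = ↔-trans uncons↔ (↔-trans (A↔ ×-↔ Vec↔Fin^ n A↔) (↔-sym *↔×))
  where
  uncons↔ : Vec A (suc n) ↔ (A × Vec A n)
  uncons↔ = mk↔ₛ′ uncons (uncurry _∷_) (λ _ → refl) (λ { (_ ∷ _) → refl })

Part↔Fin3 : Part ↔ Fin 3
Part↔Fin3 = mk↔ₛ′ code decode code-decode decode-code
  where
  code : Part → Fin 3
  code (end false) = zero
  code (end true)  = suc zero
  code inner       = suc (suc zero)
  decode : Fin 3 → Part
  decode zero             = end false
  decode (suc zero)       = end true
  decode (suc (suc zero)) = inner
  code-decode : ∀ i → code (decode i) ≡ i
  code-decode zero             = refl
  code-decode (suc zero)       = refl
  code-decode (suc (suc zero)) = refl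
  decode-code : ∀ t → decode (code t) ≡ t
  decode-code (end false) = refl
  decode-code (end true)  = refl
  decode-code inner       = refl

lookup-≗⇒≡ : ∀ {A : Set} {n} {u v : Vec A n} → (∀ e → lookup u e ≡ lookup v e) → u ≡ v
lookup-≗⇒≡ {u = u} {v} u≗v = trans (sym (tabulate∘lookup u)) (trans (tabulate-cong u≗v) (tabulate∘lookup v))

≢⇒lookup-≢ : ∀ {n} {u v : Vec Bool n} → u ≢ v → ∃[ e ] lookup u e ≢ lookup v e
≢⇒lookup-≢ {n} {u} {v} u≢v = ¬∀⟶∃¬ n _ (λ e → lookup u e ≟ᵇ lookup v e) (u≢v ∘ lookup-≗⇒≡)

_≟ᵛ_ : ∀ {n} (u v : Vec Bool n) → Dec (u ≡ v)
_≟ᵛ_ = ≡-dec _≟ᵇ_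

∈△⇔≢ : ∀ {n} {A B : Subset n} {e} → e ∈△ A , B ⇔ lookup A e ≢ lookup B e
∈△⇔≢ {A = A} {B} {e} = mk⇔ ⇒ ⇐
  where
  ⇒ : e ∈△ A , B → lookup A e ≢ lookup B e
  ⇒ (inj₁ (e∈A , e∉B)) Aₑ≡Bₑ = e∉B (lookup⇒[]= e B (trans (sym Aₑ≡Bₑ) ([]=⇒lookup e∈A)))
  ⇒ (inj₂ (e∉A , e∈B)) Aₑ≡Bₑ = e∉A (lookup⇒[]= e A (trans Aₑ≡Bₑ ([]=⇒lookup e∈B)))
  ⇐ : lookup A e ≢ lookup B e → e ∈△ A , B
  ⇐ Aₑ≢Bₑ with lookup A e in a | lookup B e in b
  ... | true  | true  = contradiction refl Aₑ≢Bₑ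
  ... | false | false = contradiction refl Aₑ≢Bₑ
  ... | true  | false = inj₁ (lookup⇒[]= e A a , λ e∈B → contradiction (trans (sym b) ([]=⇒lookup e∈B)) λ ())
  ... | false | true  = inj₂ ((λ e∈A → contradiction (trans (sym a) ([]=⇒lookup e∈A)) λ ()) , lookup⇒[]= e B b)

module _ {n} {φ : Orientation n → Subset n} (sep : SeparatingCondition φ) where

  separating⇒injective : Injective _≡_ _≡_ φ
  separating⇒injective {O₁} {O₂} φO₁≡φO₂ with O₁ ≟ᵛ O₂
  ... | yes O₁≡O₂ = O₁≡O₂
  ... | no  O₁≢O₂ = let e , _ , e∈△ = sep O₁ O₂ O₁≢O₂ in
    contradiction (cong (λ S → lookup S e) φO₁≡φO₂) (to ∈△⇔≢ e∈△)

  separating⇒surjective : StrictlySurjective _≡_ φ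
  separating⇒surjective = finite-injective⇒surjective (Vec↔Fin^ n (↔-sym 2↔Bool)) separating⇒injective

  separating⇒bijective : Bijective _≡_ _≡_ φ
  separating⇒bijective = separating⇒injective , strictlySurjective⇒surjective separating⇒surjective

  separating⇒disjoint : ∀ O₁ O₂ → O₁ ≢ O₂ → ∀ x → ¬ (InHoc O₁ (φ O₁) x × InHoc O₂ (φ O₂) x)
  separating⇒disjoint O₁ O₂ O₁≢O₂ x (x∈₁ , x∈₂) =
    let e , Oₑ≢ , e∈△ = sep O₁ O₂ O₁≢O₂ in
    hocPart-disjoint (partOf (x e)) Oₑ≢ (to ∈△⇔≢ e∈△) (hocCoord⇒hocPart (x∈₁ e)) (hocCoord⇒hocPart (x∈₂ e))

  separating⇒bijectiveAndDisjoint : BijectiveAndDisjoint φ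
  separating⇒bijectiveAndDisjoint = separating⇒bijective , separating⇒disjoint

-- Local bijectivity

Agree : ∀ {n} → Bool → Subset n → (Fin n → Bool) → (Fin n → Bool) → Set
Agree b P u v = ∀ e → lookup P e ≡ b → u e ≡ v e

agree⇒≡ : ∀ {n} (P : Subset n) {u v : Vec Bool n} →
          Agree true P (lookup u) (lookup v) → Agree false P (lookup u) (lookup v) → u ≡ v
agree⇒≡ P {u} {v} on off = lookup-≗⇒≡ pointwise
  where
  pointwise : ∀ e → lookup u e ≡ lookup v e
  pointwise e with lookup P e in p
  ... | true  = on e p
  ... | false = off e p

module _ {n} (P : Subset n) (A B : Vec Bool n) {e : Fin n} where

  lookup-glue-on : lookup P e ≡ true → lookup (glue P A B) e ≡ lookup A e
  lookup-glue-on p = trans (lookup∘tabulate _ e) (cong (λ b → if b then lookup A e else lookup B e) p)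

  lookup-glue-off : lookup P e ≡ false → lookup (glue P A B) e ≡ lookup B e
  lookup-glue-off p = trans (lookup∘tabulate _ e) (cong (λ b → if b then lookup A e else lookup B e) p)

lookup-─-on : ∀ {n} (A P : Subset n) {e} → lookup P e ≡ true → lookup (A ─ P) e ≡ false
lookup-─-on (_ ∷ _) (true ∷ _) {zero}  _ = refl
lookup-─-on (_ ∷ A) (_ ∷ P)    {suc e} p = lookup-─-on A P p

lookup-─-off : ∀ {n} (A P : Subset n) {e} → lookup P e ≡ false → lookup (A ─ P) e ≡ lookup A e
lookup-─-off (_ ∷ _) (false ∷ _) {zero}  _ = refl
lookup-─-off (_ ∷ A) (_ ∷ P)     {suc e} p = lookup-─-off A P p

⊆∁⇒lookup-false : ∀ {n} {S P : Subset n} {e} → S ⊆ ∁ P → e ∈ P → lookup S e ≡ false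
⊆∁⇒lookup-false {S = S} {P} {e} S⊆∁P e∈P with lookup S e in s
... | false = refl
... | true  = contradiction (S⊆∁P (lookup⇒[]= e S s)) (x∈p⇒x∉∁p e∈P)

-- A self-map of {0,1}^E that is bijective exactly when φ is locally bijective at (P, O_P).
localize : ∀ {n} → Subset n → Orientation n → (Orientation n → Subset n) → Orientation n → Subset n
localize P OP φ V = glue P V (φ (glue P OP V))

module _ {n} (φ : Orientation n → Subset n) (P : Subset n) (OP : Orientation n) where

  private
    H : Orientation n → Orientation n
    H = glue P OP

    G : Orientation n → Subset n
    G = localize P OP φ

    G-on : ∀ V {e} → lookup P e ≡ true → lookup (G V) e ≡ lookup V e
    G-on V = lookup-glue-on P V (φ (H V))

    G-off : ∀ V {e} → lookup P e ≡ false → lookup (G V) e ≡ lookup (φ (H V)) e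
    G-off V = lookup-glue-off P V (φ (H V))

    H-off : ∀ V {e} → lookup P e ≡ false → lookup (H V) e ≡ lookup V e
    H-off = lookup-glue-off P OP

    label-off : ∀ V {e} → lookup P e ≡ false → lookup (φ (H V) ─ P) e ≡ lookup (φ (H V)) e
    label-off V = lookup-─-off (φ (H V)) P

  localize-separating : SeparatingCondition φ → SeparatingCondition G
  localize-separating sep V V′ V≢V′ with H V ≟ᵛ H V′
  ... | yes HV≡HV′ = separatedOnP (≢⇒lookup-≢ V≢V′)
    where
    separatedOnP : ∃[ e ] lookup V e ≢ lookup V′ e → ∃[ e ] (lookup V e ≢ lookup V′ e × e ∈△ G V , G V′)
    separatedOnP (e , Vₑ≢V′ₑ) with lookup P e in p
    ... | true  = e , Vₑ≢V′ₑ , from ∈△⇔≢ λ GVₑ≡GV′ₑ →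
          Vₑ≢V′ₑ (trans (sym (G-on V p)) (trans GVₑ≡GV′ₑ (G-on V′ p)))
    ... | false = contradiction
          (trans (sym (H-off V p)) (trans (cong (λ U → lookup U e) HV≡HV′) (H-off V′ p))) Vₑ≢V′ₑ
  ... | no HV≢HV′ with sep (H V) (H V′) HV≢HV′
  ...   | e , HVₑ≢HV′ₑ , e∈△ with lookup P e in p
  ...     | true  = contradiction (trans (lookup-glue-on P OP V p) (sym (lookup-glue-on P OP V′ p))) HVₑ≢HV′ₑ
  ...     | false =
    e , (λ Vₑ≡V′ₑ → HVₑ≢HV′ₑ (trans (H-off V p) (trans Vₑ≡V′ₑ (sym (H-off V′ p))))) ,
    from ∈△⇔≢ λ GVₑ≡GV′ₑ → to ∈△⇔≢ e∈△ (trans (sym (G-off V p)) (trans GVₑ≡GV′ₑ (G-off V′ p)))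

  module _ (sep : SeparatingCondition φ) where

    open ≡-Reasoning

    separating⇒locallyInjective : ∀ O O′ → ZeroOn P O → ZeroOn P O′ →
                                   φ (H O) ─ P ≡ φ (H O′) ─ P → O ≡ O′
    separating⇒locallyInjective O O′ zO zO′ labels≡ =
      separating⇒injective (localize-separating sep) (agree⇒≡ P on off)
      where
      on : Agree true P (lookup (G O)) (lookup (G O′))
      on e p = begin
        lookup (G O) e  ≡⟨ G-on O p ⟩
        lookup O e      ≡⟨ zO e (lookup⇒[]= e P p) ⟩
        false           ≡⟨ zO′ e (lookup⇒[]= e P p) ⟨
        lookup O′ e     ≡⟨ G-on O′ p ⟨
        lookup (G O′) e ∎
      off : Agree false P (lookup (G O)) (lookup (G O′))
      off e p = begin
        lookup (G O) e           ≡⟨ G-off O p ⟩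
        lookup (φ (H O)) e       ≡⟨ label-off O p ⟨
        lookup (φ (H O) ─ P) e   ≡⟨ cong (λ S → lookup S e) labels≡ ⟩
        lookup (φ (H O′) ─ P) e  ≡⟨ label-off O′ p ⟩
        lookup (φ (H O′)) e      ≡⟨ G-off O′ p ⟨
        lookup (G O′) e          ∎

    separating⇒locallySurjective : ∀ S → S ⊆ ∁ P → ∃[ O ] (ZeroOn P O × φ (H O) ─ P ≡ S)
    separating⇒locallySurjective S S⊆∁P = V , zeroOn , agree⇒≡ P on off
      where
      V : Orientation n
      V = proj₁ (separating⇒surjective (localize-separating sep) S)
      GVₑ≡Sₑ : ∀ e → lookup (G V) e ≡ lookup S e
      GVₑ≡Sₑ e = cong (λ T → lookup T e) (proj₂ (separating⇒surjective (localize-separating sep) S))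
      zeroOn : ZeroOn P V
      zeroOn e e∈P = trans (sym (G-on V ([]=⇒lookup e∈P))) (trans (GVₑ≡Sₑ e) (⊆∁⇒lookup-false S⊆∁P e∈P))
      on : Agree true P (lookup (φ (H V) ─ P)) (lookup S)
      on e p = trans (lookup-─-on (φ (H V)) P p) (sym (⊆∁⇒lookup-false S⊆∁P (lookup⇒[]= e P p)))
      off : Agree false P (lookup (φ (H V) ─ P)) (lookup S)
      off e p = trans (label-off V p) (trans (sym (G-off V p)) (GVₑ≡Sₑ e))

separating⇒locallyBijective : ∀ {n} {φ : Orientation n → Subset n} → SeparatingCondition φ → LocallyBijective φ
separating⇒locallyBijective {φ = φ} sep P OP =
  separating⇒locallyInjective φ P OP sep , separating⇒locallySurjective φ P OP sep

agreement : ∀ {n} → Orientation n → Orientation n → Subset n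
agreement O₁ O₂ = tabulate (λ e → does (lookup O₁ e ≟ᵇ lookup O₂ e))

module _ {n} (O₁ O₂ : Orientation n) {e : Fin n} where

  agreement-on : lookup (agreement O₁ O₂) e ≡ true → lookup O₁ e ≡ lookup O₂ e
  agreement-on p with lookup O₁ e ≟ᵇ lookup O₂ e | lookup∘tabulate (λ e → does (lookup O₁ e ≟ᵇ lookup O₂ e)) e
  ... | yes O₁ₑ≡O₂ₑ | _ = O₁ₑ≡O₂ₑ
  ... | no  _       | a = contradiction (trans (sym a) p) λ ()

  agreement-off : lookup (agreement O₁ O₂) e ≡ false → lookup O₁ e ≢ lookup O₂ e
  agreement-off p with lookup O₁ e ≟ᵇ lookup O₂ e | lookup∘tabulate (λ e → does (lookup O₁ e ≟ᵇ lookup O₂ e)) e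
  ... | yes _       | a = contradiction (trans (sym a) p) λ ()
  ... | no  O₁ₑ≢O₂ₑ | _ = O₁ₑ≢O₂ₑ

locallyBijective⇒separating : ∀ {n} {φ : Orientation n → Subset n} → LocallyBijective φ → SeparatingCondition φ
locallyBijective⇒separating {n} {φ} locallyBijective O₁ O₂ O₁≢O₂ = separatedAt (≢⇒lookup-≢ labels≢)
  where
  open ≡-Reasoning

  P : Subset n
  P = agreement O₁ O₂

  zeroed : Orientation n → Orientation n
  zeroed V = glue P (replicate n false) V

  zeroed-zeroOn : ∀ V → ZeroOn P (zeroed V)
  zeroed-zeroOn V e e∈P =
    trans (lookup-glue-on P (replicate n false) V ([]=⇒lookup e∈P)) (lookup-replicate e false)

  restore : ∀ V → Agree true P (lookup V) (lookup O₁) → glue P O₁ (zeroed V) ≡ V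
  restore V V≈O₁ = agree⇒≡ P
    (λ e p → trans (lookup-glue-on P O₁ (zeroed V) p) (sym (V≈O₁ e p)))
    (λ e p → trans (lookup-glue-off P O₁ (zeroed V) p) (lookup-glue-off P (replicate n false) V p))

  restore₁ : glue P O₁ (zeroed O₁) ≡ O₁
  restore₁ = restore O₁ (λ _ _ → refl)

  restore₂ : glue P O₁ (zeroed O₂) ≡ O₂
  restore₂ = restore O₂ (λ _ p → sym (agreement-on O₁ O₂ p))

  labels≢ : φ O₁ ─ P ≢ φ O₂ ─ P
  labels≢ labels≡ = O₁≢O₂ (begin
    O₁                    ≡⟨ restore₁ ⟨
    glue P O₁ (zeroed O₁) ≡⟨ cong (glue P O₁) zeroed≡ ⟩
    glue P O₁ (zeroed O₂) ≡⟨ restore₂ ⟩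
    O₂                    ∎)
    where
    zeroed≡ : zeroed O₁ ≡ zeroed O₂
    zeroed≡ = proj₁ (locallyBijective P O₁) (zeroed O₁) (zeroed O₂) (zeroed-zeroOn O₁) (zeroed-zeroOn O₂)
                (subst₂ (λ A B → φ A ─ P ≡ φ B ─ P) (sym restore₁) (sym restore₂) labels≡)

  separatedAt : ∃[ e ] lookup (φ O₁ ─ P) e ≢ lookup (φ O₂ ─ P) e →
                ∃[ e ] (lookup O₁ e ≢ lookup O₂ e × e ∈△ φ O₁ , φ O₂)
  separatedAt (e , labelsₑ≢) with lookup P e in p
  ... | true  = contradiction (trans (lookup-─-on (φ O₁) P p) (sym (lookup-─-on (φ O₂) P p))) labelsₑ≢
  ... | false = e , agreement-off O₁ O₂ p , from ∈△⇔≢ λ φO₁ₑ≡φO₂ₑ →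
    labelsₑ≢ (trans (lookup-─-off (φ O₁) P p) (trans φO₁ₑ≡φO₂ₑ (sym (lookup-─-off (φ O₂) P p))))

-- Tilings of subcubes

-- Orientations and labels are functions, so that dropping the first coordinate is definitional.
record Family (n : ℕ) : Set₁ where
  field
    Index       : Set
    orientation : Index → Fin n → Bool
    label       : Index → Fin n → Bool

open Family

tailFamily : ∀ {n} → Family (suc n) → Family n
tailFamily F = record
  { Index       = Index F
  ; orientation = λ i → orientation F i ∘ suc
  ; label       = λ i → label F i ∘ suc
  }

_↾_ : ∀ {n} → Family (suc n) → Part → Family n
F ↾ t = record
  { Index       = Σ (Index F) λ i → hocPart (label F i zero) (orientation F i zero) t
  ; orientation = orientation (tailFamily F) ∘ proj₁
  ; label       = label (tailFamily F) ∘ proj₁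
  }

InCell : ∀ {n} (F : Family n) → Index F → Face n → Set
InCell F i = FaceInHoc (orientation F i) (label F i)

fixPart : Bool → Bool → Part → Part
fixPart true  w _ = end w
fixPart false _ t = t

fixOn : ∀ {n} → Subset n → (Fin n → Bool) → Face n → Face n
fixOn []      W []      = []
fixOn (p ∷ P) W (t ∷ f) = fixPart p (W zero) t ∷ fixOn P (W ∘ suc) f

-- The cells of F tile the subcube in which the coordinates in P are fixed to W.
record Tiling {n} (P : Subset n) (W : Fin n → Bool) (F : Family n) : Set where
  field
    cover    : ∀ f → ∃[ i ] InCell F i (fixOn P W f)
    disjoint : ∀ f {i j} → InCell F i (fixOn P W f) → InCell F j (fixOn P W f) → i ≡ j

slice : ∀ {n p P W} {F : Family (suc n)} → Tiling (p ∷ P) W F → ∀ t →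
        Tiling P (W ∘ suc) (F ↾ fixPart p (W zero) t)
slice {p = p} {P} {W} {F} T t = record
  { cover    = λ f → let i , i∋f = Tiling.cover T (t ∷ f) in (i , i∋f zero) , i∋f ∘ suc
  ; disjoint = λ f {(i , i₀)} {(j , j₀)} i∋f j∋f →
      Σ-≡,≡→≡ (Tiling.disjoint T (t ∷ f) (cons i₀ i∋f) (cons j₀ j∋f) , hocPart-irrelevant _ _ _)
  }
  where
  cons : ∀ {i f} → hocPart (label F i zero) (orientation F i zero) (fixPart p (W zero) t) →
         InCell (tailFamily F) i (fixOn P (W ∘ suc) f) → InCell F i (fixOn (p ∷ P) W (t ∷ f))
  cons h₀ h zero    = h₀
  cons h₀ h (suc e) = h e

Labelled : ∀ {n} → Subset n → (Fin n → Bool) → (Fin n → Bool) → (F : Family n) → Index F → Set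
Labelled P W r F i = Agree true P (orientation F i) W × Agree false P (label F i) r

UniqueLabel : ∀ {n} → Subset n → (Fin n → Bool) → (Fin n → Bool) → Family n → Set
UniqueLabel P W r F = ∃! _≡_ (Labelled P W r F)

module _ {n} {P : Subset n} {W r : Fin (suc n) → Bool} {F : Family (suc n)} where

  private
    TailLabelled : Index F → Set
    TailLabelled = Labelled P (W ∘ suc) (r ∘ suc) (tailFamily F)

  labelled-tail : ∀ {p i} → Labelled (p ∷ P) W r F i → TailLabelled i
  labelled-tail (on , off) = on ∘ suc , off ∘ suc

  labelled-fixed : ∀ {i} → orientation F i zero ≡ W zero → TailLabelled i → Labelled (true ∷ P) W r F i
  labelled-fixed o₀ (on , off) = (λ { zero _ → o₀ ; (suc e) → on e }) , (λ { zero () ; (suc e) → off e })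

  labelled-free : ∀ {i} → label F i zero ≡ r zero → TailLabelled i → Labelled (false ∷ P) W r F i
  labelled-free l₀ (on , off) = (λ { zero () ; (suc e) → on e }) , (λ { zero _ → l₀ ; (suc e) → off e })

  uniqueLabel-fixed : UniqueLabel P (W ∘ suc) (r ∘ suc) (F ↾ end (W zero)) → UniqueLabel (true ∷ P) W r F
  uniqueLabel-fixed ((i , W₀≡oᵢ₀) , i-labelled , i-unique) =
    i , labelled-fixed (sym W₀≡oᵢ₀) i-labelled ,
    λ j-labelled → cong proj₁ (i-unique {_ , sym (proj₁ j-labelled zero refl)} (labelled-tail j-labelled))

  uniqueLabel-free : (∀ t → UniqueLabel P (W ∘ suc) (r ∘ suc) (F ↾ t)) → UniqueLabel (false ∷ P) W r F
  uniqueLabel-free U with r zero in r₀ | U inner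
  ... | true  | (k , lₖ₀) , k-labelled , k-unique =
    k , labelled-free (trans lₖ₀ (sym r₀)) k-labelled ,
    λ j-labelled → cong proj₁ (k-unique {_ , trans (proj₂ j-labelled zero refl) r₀} (labelled-tail j-labelled))
  ... | false | (k , lₖ₀) , k-labelled , k-unique = overOtherEnd (U (end b)) (U (end (not b)))
    where
    -- k, the cell over the interior slice with the wanted tail label, is also the one over the end b;
    -- since k contains the first coordinate in its label, the wanted cell lies over the end not b.
    b : Bool
    b = orientation F k zero

    overOtherEnd : UniqueLabel P (W ∘ suc) (r ∘ suc) (F ↾ end b) →
                   UniqueLabel P (W ∘ suc) (r ∘ suc) (F ↾ end (not b)) → UniqueLabel (false ∷ P) W r F
    overOtherEnd (_ , _ , unique-at-b) ((c , not-b≡o꜀₀) , c-labelled , unique-at-not-b) =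
      c , labelled-free (trans c-outside (sym r₀)) c-labelled , c-unique
      where
      k-unique-at-b : ∀ {j} → b ≡ orientation F j zero → TailLabelled j → k ≡ j
      k-unique-at-b b≡oⱼ₀ j-labelled =
        cong proj₁ (trans (sym (unique-at-b {k , refl} k-labelled)) (unique-at-b {_ , b≡oⱼ₀} j-labelled))

      c-outside : label F c zero ≡ false
      c-outside with label F c zero in l꜀₀
      ... | false = refl
      ... | true  = contradiction
        (trans (cong (λ i → orientation F (proj₁ i) zero) (k-unique {c , l꜀₀} c-labelled)) (sym not-b≡o꜀₀))
        (not-¬ refl)

      c-unique : ∀ {j} → Labelled (false ∷ P) W r F j → c ≡ j
      c-unique {j} j-labelled with b ≟ᵇ orientation F j zero
      ... | no  b≢oⱼ₀ = cong proj₁ (unique-at-not-b {j , sym (¬-not (b≢oⱼ₀ ∘ sym))} (labelled-tail j-labelled))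
      ... | yes b≡oⱼ₀ = contradiction
        (trans (sym lₖ₀) (trans (cong (λ i → label F i zero) (k-unique-at-b b≡oⱼ₀ (labelled-tail j-labelled)))
                                (trans (proj₂ j-labelled zero refl) r₀)))
        λ ()

tiling⇒uniqueLabel : ∀ {n} {P : Subset n} {W} {F : Family n} → Tiling P W F → ∀ r → UniqueLabel P W r F
tiling⇒uniqueLabel {P = []} T r =
  let i , _ = Tiling.cover T [] in i , ((λ ()) , (λ ())) , λ _ → Tiling.disjoint T [] (λ ()) (λ ())
tiling⇒uniqueLabel {P = true ∷ P}  T r = uniqueLabel-fixed (tiling⇒uniqueLabel (slice T inner) (r ∘ suc))
tiling⇒uniqueLabel {P = false ∷ P} T r = uniqueLabel-free (λ t → tiling⇒uniqueLabel (slice T t) (r ∘ suc))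

orientationFamily : ∀ {n} → (Orientation n → Subset n) → Family n
orientationFamily {n} φ = record { Index = Orientation n ; orientation = lookup ; label = lookup ∘ φ }

module _ {n} {φ : Orientation n → Subset n} (partition : PartitionsCube φ) where

  partition⇒tiling : ∀ P W → Tiling P W (orientationFamily φ)
  partition⇒tiling P W = record
    { cover    = λ f → let O , x∈O = proj₁ partition (centre (fixOn P W f)) (centre-inCube (fixOn P W f))
                       in O , to (centre∈hoc⇔ O (φ O) (fixOn P W f)) x∈O
    ; disjoint = λ f {O} {O′} f∈O f∈O′ → proj₂ partition O O′ (centre (fixOn P W f))
        (from (centre∈hoc⇔ O (φ O) (fixOn P W f)) f∈O) (from (centre∈hoc⇔ O′ (φ O′) (fixOn P W f)) f∈O′)
    }

  partition⇒separating : SeparatingCondition φ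
  partition⇒separating O₁ O₂ O₁≢O₂
    with any? (λ e → ¬? (lookup O₁ e ≟ᵇ lookup O₂ e) ×-dec ¬? (lookup (φ O₁) e ≟ᵇ lookup (φ O₂) e))
  ... | yes (e , Oₑ≢ , φₑ≢) = e , Oₑ≢ , from ∈△⇔≢ φₑ≢
  ... | no unseparated = contradiction (sameLabel⇒≡ O₁-labelled O₂-labelled) O₁≢O₂
    where
    P : Subset n
    P = agreement O₁ O₂
    sameLabel⇒≡ : ∀ {O O′} → Labelled P (lookup O₁) (lookup (φ O₁)) (orientationFamily φ) O →
                  Labelled P (lookup O₁) (lookup (φ O₁)) (orientationFamily φ) O′ → O ≡ O′
    sameLabel⇒≡ O-labelled O′-labelled =
      let _ , _ , unique = tiling⇒uniqueLabel (partition⇒tiling P (lookup O₁)) (lookup (φ O₁))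
      in trans (sym (unique O-labelled)) (unique O′-labelled)
    O₁-labelled : Labelled P (lookup O₁) (lookup (φ O₁)) (orientationFamily φ) O₁
    O₁-labelled = (λ _ _ → refl) , (λ _ _ → refl)
    O₂-labelled : Labelled P (lookup O₁) (lookup (φ O₁)) (orientationFamily φ) O₂
    O₂-labelled = (λ _ p → sym (agreement-on O₁ O₂ p)) , λ e p → sym (decidable-stable
      (lookup (φ O₁) e ≟ᵇ lookup (φ O₂) e) λ φₑ≢ → unseparated (e , agreement-off O₁ O₂ p , φₑ≢))

-- Counting faces

support : Part → Bool
support (end b) = b
support inner   = true

settle : Bool → Part → Part
settle o (end _) = end o
settle o inner   = inner

settle-inHoc : ∀ {n} (O : Orientation n) (f : Face n) →
               FaceInHoc (lookup O) (lookup (map support f)) (zipWith settle O f)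
settle-inHoc (o ∷ _) (end _ ∷ _) zero    = refl
settle-inHoc (o ∷ _) (inner ∷ _) zero    = refl
settle-inHoc (_ ∷ O) (_ ∷ f)     (suc e) = settle-inHoc O f e

settle-injective : ∀ {n} (O : Orientation n) {f f′ : Face n} →
                   zipWith settle O f ≡ zipWith settle O f′ → map support f ≡ map support f′ → f ≡ f′
settle-injective []      {[]}    {[]}      _        _         = refl
settle-injective (o ∷ O) {t ∷ f} {t′ ∷ f′} settled≡ supports≡ =
  let settledₜ≡ , settled≡′  = ∷-injective settled≡
      supportₜ≡ , supports≡′ = ∷-injective supports≡
  in cong₂ _∷_ (settle₁-injective t t′ settledₜ≡ supportₜ≡) (settle-injective O settled≡′ supports≡′)
  where
  settle₁-injective : ∀ t t′ → settle o t ≡ settle o t′ → support t ≡ support t′ → t ≡ t′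
  settle₁-injective (end _) (end _) _  b≡b′ = cong end b≡b′
  settle₁-injective inner   inner   _  _    = refl
  settle₁-injective (end _) inner   () _
  settle₁-injective inner   (end _) () _

module _ {n} {φ : Orientation n → Subset n} (bijectiveAndDisjoint : BijectiveAndDisjoint φ) where

  private
    surjective : Surjective _≡_ _≡_ φ
    surjective = proj₂ (proj₁ bijectiveAndDisjoint)

    disjoint : ∀ O₁ O₂ → O₁ ≢ O₂ → ∀ x → ¬ (InHoc O₁ (φ O₁) x × InHoc O₂ (φ O₂) x)
    disjoint = proj₂ bijectiveAndDisjoint

    -- The face f encodes the coordinates U ⊆ S, with S = support f those not at 0 and U the
    -- interior ones; relocate f is the face of the cell φ⁻¹(S) whose interior coordinates are U.
    cellOf : Face n → Orientation n
    cellOf f = proj₁ (surjective (map support f))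

    φ∘cellOf : ∀ f → φ (cellOf f) ≡ map support f
    φ∘cellOf f = proj₂ (surjective (map support f)) refl

    relocate : Face n → Face n
    relocate f = zipWith settle (cellOf f) f

    relocate-inCell : ∀ f → FaceInHoc (lookup (cellOf f)) (lookup (φ (cellOf f))) (relocate f)
    relocate-inCell f = subst (λ S → FaceInHoc (lookup (cellOf f)) (lookup S) (relocate f))
                              (sym (φ∘cellOf f)) (settle-inHoc (cellOf f) f)

    centre-relocate∈hoc : ∀ f → InHoc (cellOf f) (φ (cellOf f)) (centre (relocate f))
    centre-relocate∈hoc f = from (centre∈hoc⇔ (cellOf f) (φ (cellOf f)) (relocate f)) (relocate-inCell f)

    relocate-injective : Injective _≡_ _≡_ relocate
    relocate-injective {f} {f′} relocated≡ =
      settle-injective (cellOf f) (trans relocated≡ (cong (λ O → zipWith settle O f′) (sym cells≡))) supports≡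
      where
      cells≡ : cellOf f ≡ cellOf f′
      cells≡ with cellOf f ≟ᵛ cellOf f′
      ... | yes O≡O′ = O≡O′
      ... | no  O≢O′ = ⊥-elim (disjoint _ _ O≢O′ (centre (relocate f))
             ( centre-relocate∈hoc f
             , subst (InHoc (cellOf f′) (φ (cellOf f′)) ∘ centre) (sym relocated≡) (centre-relocate∈hoc f′)))
      supports≡ : map support f ≡ map support f′
      supports≡ = trans (sym (φ∘cellOf f)) (trans (cong φ cells≡) (φ∘cellOf f′))

  bijectiveAndDisjoint⇒partition : PartitionsCube φ
  bijectiveAndDisjoint⇒partition = cover , disjoint′
    where
    cover : ∀ x → InCube x → ∃[ O ] InHoc O (φ O) x
    cover x cube =
      let f , relocate-f≡x = finite-injective⇒surjective (Vec↔Fin^ n Part↔Fin3) relocate-injective (faceOf x)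
          O = cellOf f
      in O , faceOf∈hoc⇒∈hoc O (φ O) cube
               (subst (FaceInHoc (lookup O) (lookup (φ O))) relocate-f≡x (relocate-inCell f))
    disjoint′ : ∀ O O′ x → InHoc O (φ O) x → InHoc O′ (φ O′) x → O ≡ O′
    disjoint′ O O′ x x∈O x∈O′ with O ≟ᵛ O′
    ... | yes O≡O′ = O≡O′
    ... | no  O≢O′ = ⊥-elim (disjoint O O′ O≢O′ x (x∈O , x∈O′))

proposition4p2 : (n : ℕ) (φ : Orientation n → Subset n) →
    ((PartitionsCube φ ⇔ BijectiveAndDisjoint φ) ×
    (BijectiveAndDisjoint φ ⇔ SeparatingCondition φ)) ×
    (SeparatingCondition φ ⇔ LocallyBijective φ)
proposition4p2 n φ =
  ( mk⇔ (separating⇒bijectiveAndDisjoint ∘ partition⇒separating) bijectiveAndDisjoint⇒partition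
  , mk⇔ (partition⇒separating ∘ bijectiveAndDisjoint⇒partition) separating⇒bijectiveAndDisjoint )
  , mk⇔ separating⇒locallyBijective locallyBijective⇒separating
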